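{- Let $G$ be a connected graph with $c(G) = \theta(G) = k\geq 3$, and let $K^{(1)}, \dots, K^{(k)}$ be a clique cover of $G$. Consider the Cops and Robbers game on $G$ with $k-1$ cops $C^1,\dots,C^{k-1}$, and suppose that at the start of a cops' turn each cop $C^i$ ($1\le i\le k-1$) occupies a vertex $v_i \in K^{(i)}$ with $N(v_i) \cap K^{(k)} \neq \emptyset$. If from this position the robber has a strategy to evade capture forever, then the robber occupies a vertex $u \in K^{(k)}$ such that $N(u) \cap K^{(i)} \neq \emptyset$ for every $1\le i\le k-1$.
   Context: All graphs are finite and simple; $N(x)$ is the neighbourhood of $x$. A clique cover of $G$ is a partition of $V(G)$ into sets each inducing a clique; $\theta(G)$ is the least size of a clique cover. The Cops and Robbers game on $G$: first $m$ cops are placed on vertices, then the robber is placed; players alternate turns starting with the cops; on a turn each cop (resp. the robber) moves to an adjacent vertex or stays. The cops win if after finitely many moves a cop occupies the robber's vertex. The cop number $c(G)$ is the least $m$ such that $m$ cops can always win. -}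

module Defs where

open import Level using (0ℓ)
open import Data.Nat using (ℕ; zero; suc; _<_; _∸_)
open import Data.Fin using (Fin)
open import Data.Product using (Σ; ∃; _×_; _,_)
open import Data.Sum using (_⊎_)
open import Relation.Nullary using (¬_; Dec)
open import Relation.Binary.PropositionalEquality using (_≡_; _≢_)
open import Relation.Binary.Construct.Closure.ReflexiveTransitive using (Star)

record Graph : Set₁ where
  field
    n      : ℕ
    _~_    : Fin n → Fin n → Set
    sym    : ∀ {u v} → u ~ v → v ~ u
    irrefl : ∀ {u} → ¬ (u ~ u)
    dec    : ∀ u v → Dec (u ~ v)

module _ (G : Graph) where
  open Graph G

  V : Set
  V = Fin n

  Connected : Set
  Connected = ∀ (u v : V) → Star _~_ u v

  Step : V → V → Set
  Step u v = u ≡ v ⊎ u ~ v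

  record CliqueCover (k : ℕ) : Set where
    field
      part     : V → Fin k
      nonempty : ∀ (j : Fin k) → ∃ λ v → part v ≡ j
      clique   : ∀ u v → part u ≡ part v → u ≢ v → u ~ v

  CliqueCoverNumber≡ : ℕ → Set
  CliqueCoverNumber≡ k = CliqueCover k × (∀ m → m < k → ¬ CliqueCover m)

  CopStep : ∀ {m} → (Fin m → V) → (Fin m → V) → Set
  CopStep c c' = ∀ i → Step (c i) (c' i)

  Caught : ∀ {m} → (Fin m → V) → V → Set
  Caught c r = ∃ λ i → c i ≡ r

  -- CopWin c r : cops at c, robber at r, cops to move; the cops can force a
  -- capture in finitely many moves (inductive = well-founded game tree).
  data CopWin {m : ℕ} (c : Fin m → V) (r : V) : Set where
    caught : Caught c r → CopWin c r
    move   : (c' : Fin m → V) → CopStep c c' →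
             (Caught c' r ⊎ (∀ r' → Step r r' → CopWin c' r')) →
             CopWin c r

  -- m cops can always win: some initial cop placement beats every robber
  -- placement (cops move first after the robber is placed).
  CopsWin : ℕ → Set
  CopsWin m = Σ (Fin m → V) λ c → ∀ (r : V) → CopWin c r

  CopNumber≡ : ℕ → Set
  CopNumber≡ k = CopsWin k × (∀ m → m < k → ¬ CopsWin m)

  -- RobberEvades c r : cops at c, robber at r, cops to move; the robber has
  -- a strategy to avoid capture forever.  Expressed as existence of a set S
  -- of positions (cops to move) containing (c , r) that the robber can
  -- maintain forever: no position in S is a capture, and after any cop move
  -- the robber is not caught and can step to a position in S again.
  SafeSet : ∀ {m} → ((Fin m → V) → V → Set) → Set
  SafeSet {m} S = ∀ c r → S c r →
      (∀ i → c i ≢ r) ×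
      (∀ (c' : Fin m → V) → CopStep c c' →
         (∀ i → c' i ≢ r) × (∃ λ r' → Step r r' × S c' r'))

  RobberEvades : ∀ {m} → (Fin m → V) → V → Set₁
  RobberEvades {m} c r =
    Σ ((Fin m → V) → V → Set) λ S → S c r × SafeSet S

{-# OPTIONS --safe #-}
-- A cop whose clique contains the robber's vertex can step onto the robber,
-- so in a position the robber can hold forever every cop sits in a clique
-- other than the robber's. With k − 1 cops in k − 1 distinct cliques this
-- puts the robber in K^(k). If the robber had no neighbour in K^(i), cop i
-- steps into K^(k) while the others stay put; now the only cop-free clique
-- is K^(i), and the robber cannot reach it in one move.
module Submission where

open import Defs
open import Data.Nat using (ℕ; suc; _≤_)
open import Data.Fin using (Fin; inject₁; fromℕ; toℕ; lower₁; _≟_)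
open import Data.Fin.Properties
  using (toℕ-injective; toℕ-fromℕ; inject₁-lower₁; fromℕ≢inject₁)
open import Data.Vec.Functional using (updateAt)
open import Data.Vec.Functional.Properties using (updateAt-updates; updateAt-minimal)
open import Data.Product using (∃; _×_; _,_; proj₁; proj₂)
open import Data.Sum using (inj₁; inj₂)
open import Function using (const; _∘′_)
open import Data.Empty using (⊥-elim)
open import Relation.Nullary using (¬_; yes; no)
open import Relation.Binary.PropositionalEquality
  using (_≡_; _≢_; refl; sym; trans; cong; subst)

≢fromℕ⇒inject₁ : ∀ {m} (q : Fin (suc m)) → q ≢ fromℕ m → ∃ λ j → inject₁ j ≡ q
≢fromℕ⇒inject₁ {m} q q≢m = lower₁ q m≢q , inject₁-lower₁ q m≢q
  where
  m≢q : m ≢ toℕ q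
  m≢q m≡q = q≢m (toℕ-injective (trans (sym m≡q) (sym (toℕ-fromℕ m))))

module _ (G : Graph) where

  copStep-updateAt : ∀ {m} (c : Fin m → V G) i {w} →
    Step G (c i) w → CopStep G c (updateAt c i (const w))
  copStep-updateAt c i {w} ci→w j with j ≟ i
  ... | yes refl = subst (Step G (c i)) (sym (updateAt-updates i c)) ci→w
  ... | no j≢i = inj₁ (sym (updateAt-minimal j i c j≢i))

  safe⇒¬Step : ∀ {m} {S : (Fin m → V G) → V G → Set} → SafeSet G S →
    ∀ {c r} → S c r → ∀ i → ¬ Step G (c i) r
  safe⇒¬Step safe {c} {r} s i ci→r =
    proj₁ (proj₂ (safe c r s) c′ (copStep-updateAt c i ci→r)) i (updateAt-updates i c)
    where
    c′ : Fin _ → V G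
    c′ = updateAt c i (const r)

  module _ {k} (K : CliqueCover G k) where
    open CliqueCover K

    samePart⇒Step : ∀ {u v} → part u ≡ part v → Step G u v
    samePart⇒Step {u} {v} pu≡pv with u ≟ v
    ... | yes u≡v = inj₁ u≡v
    ... | no u≢v = inj₂ (clique u v pu≡pv u≢v)

    safe⇒part≢ : ∀ {m} {S : (Fin m → V G) → V G → Set} → SafeSet G S →
      ∀ {c r} → S c r → ∀ i → part (c i) ≢ part r
    safe⇒part≢ safe s i = safe⇒¬Step safe s i ∘′ samePart⇒Step

    safe⇒part≡uncovered : ∀ {m} {S : (Fin m → V G) → V G → Set} → SafeSet G S →
      ∀ {c r} → S c r → (p : Fin k) →
      (∀ q → q ≢ p → ∃ λ i → part (c i) ≡ q) → part r ≡ p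
    safe⇒part≡uncovered safe {r = r} s p covered with part r ≟ p
    ... | yes pr≡p = pr≡p
    ... | no pr≢p = let i , pci≡pr = covered (part r) pr≢p in
                    ⊥-elim (safe⇒part≢ safe s i pci≡pr)

module _ (G : Graph) {m} (K : CliqueCover G (suc m)) {c : Fin m → V G}
         (cop-in-own-clique : ∀ i → CliqueCover.part K (c i) ≡ inject₁ i) where
  open CliqueCover K

  ownCliques-cover-≢fromℕ : ∀ q → q ≢ fromℕ m → ∃ λ j → part (c j) ≡ q
  ownCliques-cover-≢fromℕ q q≢last =
    let j , j↦q = ≢fromℕ⇒inject₁ q q≢last in j , trans (cop-in-own-clique j) j↦q

  moveToLast-covers-≢inject₁ : ∀ i {w} → part w ≡ fromℕ m →
    ∀ q → q ≢ inject₁ i → ∃ λ j → part (updateAt c i (const w) j) ≡ q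
  moveToLast-covers-≢inject₁ i w-in-last q q≢i with q ≟ fromℕ m
  ... | yes q≡last = i , trans (cong part (updateAt-updates i c))
                               (trans w-in-last (sym q≡last))
  ... | no q≢last with ≢fromℕ⇒inject₁ q q≢last
  ... | j , refl = j , trans (cong part (updateAt-minimal j i c (q≢i ∘′ cong inject₁)))
                              (cop-in-own-clique j)

lemma3p2 : (G : Graph) → (m : ℕ) → 2 ≤ m →
    Connected G → CopNumber≡ G (suc m) → CliqueCoverNumber≡ G (suc m) →
    (K : CliqueCover G (suc m)) →
    (c : Fin m → V G) → (r : V G) →
    (∀ i → CliqueCover.part K (c i) ≡ inject₁ i) →
    (∀ i → ∃ λ w → Graph._~_ G (c i) w × CliqueCover.part K w ≡ fromℕ m) →
    RobberEvades G c r →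
    CliqueCover.part K r ≡ fromℕ m ×
      (∀ i → ∃ λ w → Graph._~_ G r w × CliqueCover.part K w ≡ inject₁ i)
lemma3p2 G m _ _ _ _ K c r cop-in-own-clique cop-sees-last (S , s , safe) =
  robber-in-last , robber-sees
  where
  open Graph G using (_~_)
  open CliqueCover K

  robber-in-last : part r ≡ fromℕ m
  robber-in-last = safe⇒part≡uncovered G K safe s (fromℕ m)
                     (ownCliques-cover-≢fromℕ G K cop-in-own-clique)

  robber-sees : ∀ i → ∃ λ w → r ~ w × part w ≡ inject₁ i
  robber-sees i with cop-sees-last i
  ... | w , ci~w , w-in-last = r′ , r~r′ , r′-in-i
    where
    reply : ∃ λ r′ → Step G r r′ × S (updateAt c i (const w)) r′
    reply = proj₂ (proj₂ (safe c r s) _ (copStep-updateAt G c i (inj₂ ci~w)))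

    r′ : V G
    r′ = proj₁ reply

    r′-in-i : part r′ ≡ inject₁ i
    r′-in-i = safe⇒part≡uncovered G K safe (proj₂ (proj₂ reply)) (inject₁ i)
                (moveToLast-covers-≢inject₁ G K cop-in-own-clique i w-in-last)

    r~r′ : r ~ r′
    r~r′ with proj₁ (proj₂ reply)
    ... | inj₂ r~r′ = r~r′
    ... | inj₁ r≡r′ = ⊥-elim (fromℕ≢inject₁ (trans (sym robber-in-last)
                                                (trans (cong part r≡r′) r′-in-i)))
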